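{- Let $A$ be a set, $N\in\mathbb N$, $J\subseteq N$, and let $X,Y$ be double suits over ${}^NA$ with $X\le Y$ and $Y$ flat. Then $X+_JY=Y$.
   Context: Identify $N$ with $\{0,\dots,N-1\}$; ${}^NA$ is the set of valuations $\vec a=(a_0,\dots,a_{N-1})$; a team is a subset of ${}^NA$. For $J\subseteq N$, $\vec a\approx_J\vec b$ means they agree on $N\setminus J$. $V=V_1\cup_J V_2$ means $V_1\cup V_2=V$, $V_1\cap V_2=\emptyset$, and each $V_i$ is closed under $\approx_J$ within $V$. For pairs $X=\langle X^+,X^-\rangle$, $Y=\langle Y^+,Y^-\rangle$ of sets of teams, $X+_JY$ is the pair with $(X+_JY)^+=\{V:V=V_1\cup_JV_2$ for some $V_1\in X^+,V_2\in Y^+\}$ and $(X+_JY)^-=X^-\cap Y^-$. A suit is a nonempty set $S$ of teams such that $V'\subseteq V\in S$ implies $V'\in S$; a double suit is a pair $\langle X^+,X^-\rangle$ of suits with $X^+\cap X^-=\{\emptyset\}$. A double suit $Y$ is flat if $Y^+=\mathcal P(V)$ for some $V\subseteq{}^NA$. For double suits, $X\le Y$ means $X^+\subseteq Y^+$ and $Y^-\subseteq X^-$. -}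

module Defs where

open import Data.Nat using (ℕ)
open import Data.Fin using (Fin)
open import Data.Product using (Σ; _×_; ∃)
open import Data.Empty using (⊥)
open import Relation.Nullary using (¬_)
open import Relation.Binary.PropositionalEquality using (_≡_)
open import Data.Sum using (_⊎_)

-- Valuations ^N A, with N identified with Fin N.
Valuation : Set → ℕ → Set
Valuation A N = Fin N → A

Team : Set → ℕ → Set₁
Team A N = Valuation A N → Set

TeamSet : Set → ℕ → Set₂
TeamSet A N = Team A N → Set₁

IndexSet : ℕ → Set₁
IndexSet N = Fin N → Set

module _ {A : Set} {N : ℕ} where

  _⊆T_ : Team A N → Team A N → Set
  V ⊆T W = ∀ a → V a → W a

  EmptyTeam : Team A N → Set
  EmptyTeam V = ∀ a → ¬ V a

  _≈[_]_ : Valuation A N → IndexSet N → Valuation A N → Set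
  a ≈[ J ] b = ∀ i → ¬ J i → a i ≡ b i

  SplitJ : IndexSet N → Team A N → Team A N → Team A N → Set
  SplitJ J V V₁ V₂ =
    (∀ a → V a → V₁ a ⊎ V₂ a)
    × (∀ a → V₁ a → V a)
    × (∀ a → V₂ a → V a)
    × (∀ a → V₁ a → V₂ a → ⊥)
    × (∀ a b → V₁ a → V b → a ≈[ J ] b → V₁ b)
    × (∀ a b → V₂ a → V b → a ≈[ J ] b → V₂ b)

  record Pair : Set₂ where
    constructor ⟨_,_⟩
    field
      pos : TeamSet A N
      neg : TeamSet A N
  open Pair public

  plusJ : IndexSet N → Pair → Pair → Pair
  plusJ J X Y = ⟨ (λ V → Σ (Team A N) λ V₁ → Σ (Team A N) λ V₂ →
                          SplitJ J V V₁ V₂ × pos X V₁ × pos Y V₂)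
                , (λ V → neg X V × neg Y V) ⟩

  IsSuit : TeamSet A N → Set₁
  IsSuit S = (Σ (Team A N) λ V → S V)
           × (∀ V V′ → V′ ⊆T V → S V → S V′)

  IsDoubleSuit : Pair → Set₁
  IsDoubleSuit X = IsSuit (pos X) × IsSuit (neg X)
    × (∀ V → (pos X V × neg X V → EmptyTeam V) × (EmptyTeam V → pos X V × neg X V))

  IsFlat : Pair → Set₁
  IsFlat Y = Σ (Team A N) λ V₀ → ∀ W → (pos Y W → W ⊆T V₀) × (W ⊆T V₀ → pos Y W)

  _≤D_ : Pair → Pair → Set₁
  X ≤D Y = (∀ V → pos X V → pos Y V) × (∀ V → neg Y V → neg X V)

  _≐_ : TeamSet A N → TeamSet A N → Set₁
  S ≐ T = ∀ V → (S V → T V) × (T V → S V)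

  _≐P_ : Pair → Pair → Set₁
  X ≐P Y = (pos X ≐ pos Y) × (neg X ≐ neg Y)

module Submission where

-- Let Y⁺ = 𝒫(V₀).  The negative parts agree because
-- (X +_J Y)⁻ = X⁻ ∩ Y⁻ and Y⁻ ⊆ X⁻.  For the positive parts:
--   * (X +_J Y)⁺ ⊆ Y⁺: if V = V₁ ∪_J V₂ with V₁ ∈ X⁺ ⊆ Y⁺ and V₂ ∈ Y⁺, then
--     both pieces lie in V₀, hence so does V, i.e. V ∈ 𝒫(V₀) = Y⁺;
--   * Y⁺ ⊆ (X +_J Y)⁺: every V splits trivially as V = ∅ ∪_J V, and ∅ ∈ X⁺
--     because X⁺ is a (nonempty, downward closed) suit.

open import Defs
open import Data.Nat using (ℕ)
open import Data.Product using (Σ; _×_; _,_; proj₁; proj₂)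
open import Data.Sum using ([_,_]; inj₂)
open import Data.Empty using (⊥)

module _ {A : Set} {N : ℕ} where

  ∅ : Team A N
  ∅ _ = ⊥

  ∅⊆ : (V : Team A N) → ∅ ⊆T V
  ∅⊆ V a ()

  split-⊆ : {J : IndexSet N} {V V₁ V₂ V₀ : Team A N} → SplitJ J V V₁ V₂ →
            V₁ ⊆T V₀ → V₂ ⊆T V₀ → V ⊆T V₀
  split-⊆ (covers , _) V₁⊆V₀ V₂⊆V₀ a v = [ V₁⊆V₀ a , V₂⊆V₀ a ] (covers a v)

  split-∅ : (J : IndexSet N) (V : Team A N) → SplitJ J V ∅ V
  split-∅ J V = (λ a v → inj₂ v) , (λ a ()) , (λ a v → v) , (λ a ())
              , (λ a b ()) , (λ a b _ v _ → v)

  suit-∅ : {S : TeamSet A N} → IsSuit S → S ∅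
  suit-∅ ((V , V∈S) , down) = down V ∅ (∅⊆ V) V∈S

  -- If X⁺ ⊆ Y⁺ and Y⁺ = 𝒫(V₀), then (X +_J Y)⁺ ⊆ Y⁺: Y⁺ is closed under ∪_J.
  plus-pos-⊆ : (J : IndexSet N) (X Y : Pair {A} {N}) →
               (∀ V → pos X V → pos Y V) → IsFlat Y →
               ∀ V → pos (plusJ J X Y) V → pos Y V
  plus-pos-⊆ J X Y X⁺⊆Y⁺ (V₀ , flat) V (V₁ , V₂ , split , V₁∈X⁺ , V₂∈Y⁺) =
    proj₂ (flat V) (split-⊆ split (proj₁ (flat V₁) (X⁺⊆Y⁺ V₁ V₁∈X⁺))
                                  (proj₁ (flat V₂) V₂∈Y⁺))

  plus-pos-⊇ : (J : IndexSet N) (X Y : Pair {A} {N}) → pos X ∅ →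
               ∀ V → pos Y V → pos (plusJ J X Y) V
  plus-pos-⊇ J X Y ∅∈X⁺ V V∈Y⁺ = ∅ , V , split-∅ J V , ∅∈X⁺ , V∈Y⁺

  plus-neg : (J : IndexSet N) (X Y : Pair {A} {N}) →
             (∀ V → neg Y V → neg X V) → neg (plusJ J X Y) ≐ neg Y
  plus-neg J X Y Y⁻⊆X⁻ V = proj₂ , λ V∈Y⁻ → Y⁻⊆X⁻ V V∈Y⁻ , V∈Y⁻

mainTheorem11 : (A : Set) (N : ℕ) (J : IndexSet N) (X Y : Pair {A} {N}) →
    IsDoubleSuit X → IsDoubleSuit Y → X ≤D Y → IsFlat Y →
    plusJ J X Y ≐P Y
mainTheorem11 A N J X Y (X⁺-suit , _) _ (X⁺⊆Y⁺ , Y⁻⊆X⁻) Y-flat =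
  (λ V → plus-pos-⊆ J X Y X⁺⊆Y⁺ Y-flat V , plus-pos-⊇ J X Y (suit-∅ X⁺-suit) V)
  , plus-neg J X Y Y⁻⊆X⁻
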